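{- Let $l:K\to L$ and $m:L\to M$ be morphisms of monographs and let $D$, $k:K\to D$, $f:D\to M$ be a pushout complement of $l$ and $m$. Then $f[\mathrm{E}_D]=\mathrm{E}_M\setminus m[L']$, where $L'=\mathrm{E}_L\setminus l[\mathrm{E}_K]$.
   Context: A monograph is a set $A$ of ordered pairs which is a functional relation with domain some set $\mathrm{E}_A$ (the edges) such that each $A(x)$ is a function $\lambda\to\mathrm{E}_A$ for some ordinal $\lambda=|x|$; $x_\iota$ denotes $A(x)(\iota)$. A morphism $f:A\to B$ is a function $f:\mathrm{E}_A\to\mathrm{E}_B$ with $|f(x)|=|x|$ and $f(x_\iota)=f(x)_\iota$; $\mathbf{Monogr}$ is the resulting category. A pushout complement of $l:K\to L$ and $m:L\to M$ is a monograph $D$ with morphisms $k:K\to D$, $f:D\to M$ such that $\langle m,f,M\rangle$ is a pushout in $\mathbf{Monogr}$ of $L\xleftarrow{l}K\xrightarrow{k}D$. -}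

module Defs where

open import Level using (0ℓ)
open import Data.Unit using (⊤)
open import Data.Product using (Σ; ∃; _×_; _,_)
open import Relation.Binary.PropositionalEquality using (_≡_; subst; sym)
open import Relation.Unary using (Pred; _∖_; _≐_)

-- A monograph: a set of edges E, each edge x having a length ∣ x ∣ (an
-- ordinal λ) and a sequence  x at_ : λ → E  (x at ι is x_ι).
record Monograph {Ord : Set} (Idx : Ord → Set) : Set₁ where
  field
    E    : Set
    ∣_∣  : E → Ord
    _at_ : (x : E) → Idx ∣ x ∣ → E

open Monograph public

record Hom {Ord : Set} {Idx : Ord → Set} (A B : Monograph Idx) : Set where
  field
    fun      : E A → E B
    len-pres : ∀ x → ∣_∣ B (fun x) ≡ ∣_∣ A x
    seq-pres : ∀ x (ι : Idx (∣_∣ A x)) →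
               fun (_at_ A x ι) ≡ _at_ B (fun x) (subst Idx (sym (len-pres x)) ι)

open Hom public

-- ⟨m , f , M⟩ is a pushout in Monogr of  L <-l- K -k-> D.
-- Morphisms are equal iff their underlying edge functions are equal
-- (stated pointwise).
IsPushout : {Ord : Set} {Idx : Ord → Set} {K L D M : Monograph Idx} →
            Hom K L → Hom K D → Hom L M → Hom D M → Set₁
IsPushout {Idx = Idx} {K} {L} {D} {M} l k m f =
  (∀ x → fun m (fun l x) ≡ fun f (fun k x)) ×
  ((X : Monograph Idx) (g : Hom L X) (h : Hom D X) →
   (∀ x → fun g (fun l x) ≡ fun h (fun k x)) →
   Σ (Hom M X) λ u →
     (∀ y → fun u (fun m y) ≡ fun g y) ×
     (∀ y → fun u (fun f y) ≡ fun h y) ×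
     ((u′ : Hom M X) →
        (∀ y → fun u′ (fun m y) ≡ fun g y) →
        (∀ y → fun u′ (fun f y) ≡ fun h y) →
        ∀ z → fun u′ z ≡ fun u z))

IsPushoutComplement : {Ord : Set} {Idx : Ord → Set} {K L D M : Monograph Idx} →
                      Hom K L → Hom L M → Hom K D → Hom D M → Set₁
IsPushoutComplement l m k f = IsPushout l k m f

image : {A B : Set} → (A → B) → Pred A 0ℓ → Pred B 0ℓ
image h S y = ∃ λ x → S x × h x ≡ y

Edges : {A : Set} → Pred A 0ℓ
Edges _ = ⊤

{-# OPTIONS --safe #-}
-- Both inclusions come from mapping the pushout into a monograph made of M
-- and a disjoint copy of further edges. Duplicating the edges of M outside
-- m[L] ∪ f[D] gives a second morphism out of M agreeing with the inclusion
-- on m and f, so by uniqueness m and f are jointly surjective; an edge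
-- outside m[L′] then lies in f[D], since m∘l = f∘k. Adjoining a copy of the
-- edges of L outside l[K] gives a cocone whose mediating morphism sends f[D]
-- into M but m x, for x ∉ l[K], into the copy; so f[D] misses m[L′].
-- Deciding membership in these images is where excluded middle is used.
module Submission where

open import Defs
open import Level using (0ℓ)
open import Axiom.ExcludedMiddle using (ExcludedMiddle)
open import Relation.Unary using (Pred; Decidable; _∪_; _∖_; _⊆_; _≐_)
open import Data.Unit using (tt)
open import Data.Empty using (⊥-elim)
open import Data.Sum using (_⊎_; inj₁; inj₂)
open import Data.Product using (_,_; proj₁; proj₂)
open import Relation.Nullary using (yes; no)
open import Relation.Binary.PropositionalEquality
open import Relation.Binary.PropositionalEquality.Properties using (subst-sym-subst)

module _ {Ord : Set} {Idx : Ord → Set} where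

  idₕ : {A : Monograph Idx} → Hom A A
  idₕ = record { fun = λ x → x ; len-pres = λ _ → refl ; seq-pres = λ _ _ → refl }

  _∘ₕ_ : {A B C : Monograph Idx} → Hom B C → Hom A B → Hom A C
  _∘ₕ_ {A} {B} {C} g f = record
    { fun      = λ x → fun g (fun f x)
    ; len-pres = λ x → trans (len-pres g (fun f x)) (len-pres f x)
    ; seq-pres = λ x ι → begin
        fun g (fun f (_at_ A x ι))
          ≡⟨ cong (fun g) (seq-pres f x ι) ⟩
        fun g (_at_ B (fun f x) (subst Idx (sym (len-pres f x)) ι))
          ≡⟨ seq-pres g (fun f x) _ ⟩
        _at_ C (fun g (fun f x)) (subst Idx (sym (len-pres g (fun f x))) (subst Idx (sym (len-pres f x)) ι))
          ≡⟨ cong (_at_ C (fun g (fun f x))) (subst-sym-trans (len-pres g (fun f x)) (len-pres f x)) ⟩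
        _at_ C (fun g (fun f x)) (subst Idx (sym (trans (len-pres g (fun f x)) (len-pres f x))) ι)
          ∎
    }
    where
    open ≡-Reasoning
    subst-sym-trans : {a b c : Ord} (q : a ≡ b) (p : b ≡ c) {ι : Idx c} →
                      subst Idx (sym q) (subst Idx (sym p) ι) ≡ subst Idx (sym (trans q p)) ι
    subst-sym-trans refl refl = refl

  SubedgeClosed : (A : Monograph Idx) → Pred (E A) 0ℓ → Set
  SubedgeClosed A S = ∀ x → S x → ∀ ι → S (_at_ A x ι)

  image-subedgeClosed : {A B : Monograph Idx} (h : Hom A B) → SubedgeClosed B (image (fun h) Edges)
  image-subedgeClosed {A} {B} h _ (x , _ , refl) ι =
    _at_ A x (subst Idx (len-pres h x) ι) , tt ,
    trans (seq-pres h x _) (cong (_at_ B (fun h x)) (subst-sym-subst (len-pres h x)))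

  ∪-subedgeClosed : {A : Monograph Idx} {S T : Pred (E A) 0ℓ} →
                    SubedgeClosed A S → SubedgeClosed A T → SubedgeClosed A (S ∪ T)
  ∪-subedgeClosed S-closed T-closed x (inj₁ s) ι = inj₁ (S-closed x s ι)
  ∪-subedgeClosed S-closed T-closed x (inj₂ t) ι = inj₂ (T-closed x t ι)

  -- B beside a copy of A, except that sub-edges lying in S are redirected
  -- along φ into B (the copies of edges in S are then unreachable junk).
  module Glue {A B : Monograph Idx} (φ : Hom A B) {S : Pred (E A) 0ℓ}
              (S? : Decidable S) (S-closed : SubedgeClosed A S) where

    route-fun : E A → E B ⊎ E A
    route-fun a with S? a
    ... | yes _ = inj₁ (fun φ a)
    ... | no _  = inj₂ a

    route-on-S : ∀ {a} → S a → route-fun a ≡ inj₁ (fun φ a)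
    route-on-S {a} s with S? a
    ... | yes _ = refl
    ... | no ¬s = ⊥-elim (¬s s)

    route-inj₁⇒S : ∀ {a b} → route-fun a ≡ inj₁ b → S a
    route-inj₁⇒S {a} e with S? a
    route-inj₁⇒S e | yes s = s
    route-inj₁⇒S () | no _

    glued-len : E B ⊎ E A → Ord
    glued-len (inj₁ b) = ∣_∣ B b
    glued-len (inj₂ a) = ∣_∣ A a

    glued-at : (z : E B ⊎ E A) → Idx (glued-len z) → E B ⊎ E A
    glued-at (inj₁ b) ι = inj₁ (_at_ B b ι)
    glued-at (inj₂ a) ι = route-fun (_at_ A a ι)

    Glued : Monograph Idx
    Glued = record { E = E B ⊎ E A ; ∣_∣ = glued-len ; _at_ = glued-at }

    inject : Hom B Glued
    inject = record { fun = inj₁ ; len-pres = λ _ → refl ; seq-pres = λ _ _ → refl }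

    route-len : ∀ a → glued-len (route-fun a) ≡ ∣_∣ A a
    route-len a with S? a
    ... | yes _ = len-pres φ a
    ... | no _  = refl

    route-seq : ∀ a ι → route-fun (_at_ A a ι) ≡ glued-at (route-fun a) (subst Idx (sym (route-len a)) ι)
    route-seq a ι with S? a
    ... | yes s = trans (route-on-S (S-closed a s ι)) (cong inj₁ (seq-pres φ a ι))
    ... | no _  = refl

    route : Hom A Glued
    route = record { fun = route-fun ; len-pres = route-len ; seq-pres = route-seq }

  module _ {K L D M : Monograph Idx} (l : Hom K L) (k : Hom K D) (m : Hom L M) (f : Hom D M)
           (pushout : IsPushout l k m f) where

    pushout-jointly-epic : {X : Monograph Idx} (u u′ : Hom M X) →
                           (∀ y → fun u (fun m y) ≡ fun u′ (fun m y)) →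
                           (∀ d → fun u (fun f d) ≡ fun u′ (fun f d)) →
                           ∀ z → fun u z ≡ fun u′ z
    pushout-jointly-epic {X} u u′ agree-m agree-f z
      with proj₂ pushout X (u ∘ₕ m) (u ∘ₕ f) (λ x → cong (fun u) (proj₁ pushout x))
    ... | _ , _ , _ , unique =
      trans (unique u (λ _ → refl) (λ _ → refl) z)
            (sym (unique u′ (λ y → sym (agree-m y)) (λ d → sym (agree-f d)) z))

    pushout-jointly-surjective : Decidable (image (fun m) Edges ∪ image (fun f) Edges) →
                                 ∀ y → (image (fun m) Edges ∪ image (fun f) Edges) y
    pushout-jointly-surjective covered? y =
      route-inj₁⇒S (sym (pushout-jointly-epic inject route
        (λ x → sym (route-on-S (inj₁ (x , tt , refl))))
        (λ d → sym (route-on-S (inj₂ (d , tt , refl))))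
        y))
      where
      open Glue idₕ covered?
        (∪-subedgeClosed (image-subedgeClosed m) (image-subedgeClosed f))

    pushout-disjoint : Decidable (image (fun l) Edges) →
                       ∀ {x d} → fun m x ≡ fun f d → image (fun l) Edges x
    pushout-disjoint l-image? {x} {d} mx≡fd = route-inj₁⇒S route-x≡fd
      where
      open Glue m l-image? (image-subedgeClosed l)
      open ≡-Reasoning

      route-x≡fd : fun route x ≡ inj₁ (fun f d)
      route-x≡fd
        with proj₂ pushout Glued route (inject ∘ₕ f)
               (λ z → trans (route-on-S (z , tt , refl)) (cong inj₁ (proj₁ pushout z)))
      ... | u , u∘m , u∘f , _ = begin
        fun route x      ≡⟨ sym (u∘m x) ⟩
        fun u (fun m x)  ≡⟨ cong (fun u) mx≡fd ⟩
        fun u (fun f d)  ≡⟨ u∘f d ⟩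
        inj₁ (fun f d)   ∎

corollary4 : ExcludedMiddle 0ℓ →
    {Ord : Set} {Idx : Ord → Set} {K L D M : Monograph Idx}
    (l : Hom K L) (m : Hom L M) (k : Hom K D) (f : Hom D M) →
    IsPushoutComplement l m k f →
    image (fun f) Edges ≐ (Edges ∖ image (fun m) (Edges ∖ image (fun l) Edges))
corollary4 em l m k f pushout@(commutes , _) = f-image⊆ , ⊆f-image
  where
  f-image⊆ : image (fun f) Edges ⊆ (Edges ∖ image (fun m) (Edges ∖ image (fun l) Edges))
  f-image⊆ (d , _ , refl) =
    tt , λ { (x , (_ , x∉l[K]) , mx≡fd) → x∉l[K] (pushout-disjoint l k m f pushout (λ _ → em) mx≡fd) }

  ⊆f-image : (Edges ∖ image (fun m) (Edges ∖ image (fun l) Edges)) ⊆ image (fun f) Edges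
  ⊆f-image {y} (_ , y∉m[L′]) with pushout-jointly-surjective l k m f pushout (λ _ → em) y
  ... | inj₂ y∈f[D] = y∈f[D]
  ... | inj₁ (x , _ , refl) with em {image (fun l) Edges x}
  ...   | yes (x′ , _ , refl) = fun k x′ , tt , sym (commutes x′)
  ...   | no x∉l[K] = ⊥-elim (y∉m[L′] (x , (tt , x∉l[K]) , refl))
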